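{- For integers $C\geq 3$, $L\geq 3$ and $k\in\{1,\dots,C-2\}$, $\gamma_{P,k}(WKP_{(C,L)})\geq (C-k-1)C^{L-2}$.
   Context: For a graph $G$, $S\subseteq V(G)$ and an integer $k\ge 0$, define $\mathcal{P}^0_{G,k}(S)=N_G[S]$ (closed neighbourhood of $S$) and $\mathcal{P}^{i+1}_{G,k}(S)=\bigcup\{N_G[v] : v\in \mathcal{P}^i_{G,k}(S),\ |N_G[v]\setminus \mathcal{P}^i_{G,k}(S)|\le k\}$. These sets increase and stabilize at a set $\mathcal{P}^\infty_{G,k}(S)$. A $k$-power dominating set ($k$-PDS) is a set $S$ with $\mathcal{P}^\infty_{G,k}(S)=V(G)$, and $\gamma_{P,k}(G)$ is the minimum cardinality of a $k$-PDS of $G$. Let $[C]_0=\{0,\dots,C-1\}$. The WK-Pyramid network $WKP_{(C,L)}$ has vertex set $\{(r,(a_r a_{r-1}\cdots a_1)) : r\in\{1,\dots,L\},\ a_i\in[C]_0\}\cup\{(0,(1))\}$; a vertex $(r,(a_r\cdots a_1))$ is said to be at level $r$. The vertex $(0,(1))$ is adjacent to every vertex at level $1$. A vertex $(r,(a_r\cdots a_1))$ with $r>0$ is adjacent to: (1) the vertices $(r,(a_r\cdots a_2 b))$ with $b\in[C]_0$, $b\ne a_1$; (2) the vertex $(r,(a_r\cdots a_{j+1}a_{j-1}(a_j)^{j-1}))$ if there is a $j$ with $2\le j\le r$, $a_{j-1}=a_{j-2}=\cdots=a_1$ and $a_j\ne a_{j-1}$, where $(a_j)^{j-1}$ denotes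 $a_j$ repeated $j-1$ times; (3) the vertices $(r+1,(a_r\cdots a_1 b))$ for $b\in[C]_0$ (when $r<L$); (4) the vertex $(r-1,(a_r\cdots a_2))$ (for $r=1$ this is $(0,(1))$). -}

module Defs where

open import Data.Nat using (ℕ; zero; suc; _≤_; _<ᵇ_; _≤ᵇ_)
open import Data.Fin using (Fin)
import Data.Fin as Fin
open import Data.Bool using (Bool; true; false; _∧_; _∨_; not; if_then_else_)
open import Data.List using (List; []; _∷_; map; concatMap; filter; filterᵇ; length; allFin; replicate; _++_)
open import Data.Bool.ListAction using (any)
open import Data.List.Properties using (≡-dec)
open import Data.Maybe using (Maybe; just; nothing)
open import Data.Product using (∃)
open import Relation.Nullary.Decidable using (does; ¬?)
open import Relation.Binary.PropositionalEquality using (_≡_)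

-- A vertex (r,(a_r ... a_1)) of WKP_(C,L) is stored as the list
-- a_1 ∷ a_2 ∷ ... ∷ a_r ∷ []  (lowest digit a_1 first).
-- The apex (0,(1)) is the empty list.  Vertices = words of length ≤ L.
Word : ℕ → Set
Word C = List (Fin C)

wordsOfLength : (C : ℕ) → ℕ → List (Word C)
wordsOfLength C zero = [] ∷ []
wordsOfLength C (suc n) = concatMap (λ w → map (_∷ w) (allFin C)) (wordsOfLength C n)

vertices : (C L : ℕ) → List (Word C)
vertices C zero = wordsOfLength C zero
vertices C (suc L) = vertices C L ++ wordsOfLength C (suc L)

IsVertex : (C L : ℕ) → Word C → Set
IsVertex C L w = length w ≤ L

module _ {C : ℕ} where

  _==_ : Word C → Word C → Bool
  u == v = does (≡-dec Fin._≟_ u v)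

  siblings : Word C → List (Word C)
  siblings [] = []
  siblings (x ∷ t) = map (λ b → b ∷ t) (filter (λ b → ¬? (x Fin.≟ b)) (allFin C))

  -- rule (2): if a_1 = ... = a_{j-1} = x (m = j-1 ≥ 1 copies), a_j = y ≠ x,
  -- j ≤ r, the neighbour is a_r...a_{j+1} x y^{j-1}, i.e. the list y^m ++ x ∷ t.
  swapGo : Fin C → ℕ → Word C → Maybe (Word C)
  swapGo x m [] = nothing
  swapGo x m (y ∷ t) = if does (y Fin.≟ x) then swapGo x (suc m) t
                       else just (replicate m y ++ (x ∷ t))

  swapNbr : Word C → List (Word C)
  swapNbr [] = []
  swapNbr (x ∷ t) with swapGo x 1 t
  ... | just w = w ∷ []
  ... | nothing = []

  children : ℕ → Word C → List (Word C)
  children L w = if length w <ᵇ L then map (_∷ w) (allFin C) else []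

  parent : Word C → List (Word C)
  parent [] = []
  parent (x ∷ t) = t ∷ []

  nbrs : ℕ → Word C → List (Word C)
  nbrs L w = siblings w ++ swapNbr w ++ children L w ++ parent w

  inClosedNbhd : ℕ → Word C → Word C → Bool
  inClosedNbhd L u v = (u == v) ∨ any (u ==_) (nbrs L v)

module _ (C L k : ℕ) where

  outsideCount : (Word C → Bool) → Word C → ℕ
  outsideCount P v =
    length (filterᵇ (λ w → inClosedNbhd L w v ∧ not (P w)) (vertices C L))

  step : (Word C → Bool) → (Word C → Bool)
  step P u = any (λ v → P v ∧ (outsideCount P v ≤ᵇ k) ∧ inClosedNbhd L u v) (vertices C L)

  powerDom : List (Word C) → ℕ → (Word C → Bool)
  powerDom S zero u = any (inClosedNbhd L u) S
  powerDom S (suc i) = step (powerDom S i)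

  IsKPDS : List (Word C) → Set
  IsKPDS S = (u : Word C) → IsVertex C L u → ∃ λ i → powerDom S i u ≡ true

module Submission where

-- Charge every vertex s of a k-PDS S to its anchor: s itself, or its parent if s is a leaf (a vertex
-- at level L).  Fix a word w at level L − 2 and call a letter x unhit if the child x ∷ w of w is nobody's
-- anchor.  For unhit letters b ≢ x the leaf b ∷ x ∷ w is never observed: its closed neighbourhood
-- consists of its siblings, its parent x ∷ w and its swap partner x ∷ b ∷ w, all anchored at x ∷ w or
-- b ∷ w, so none of them is in S; and each of them has in its closed neighbourhood all leaves d ∷ y ∷ w
-- for some unhit y ∈ {x, b}, of which the at least #unhit − 1 with d unhit and d ≢ y are unobserved, so
-- it cannot force once #unhit ≥ k + 2.  Hence at most k + 1 children of each w are unhit, and the other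
-- C − k − 1 children of each of the C ^ (L − 2) words w are pairwise distinct anchors.

open import Defs
open import Data.Bool using (Bool; true; false; T; not; _∧_; if_then_else_)
open import Data.Bool.Properties using (T-∨; T-∧; T-≡)
open import Data.Empty using (⊥-elim)
open import Data.Fin as Fin using (Fin)
open import Data.List using (List; []; _∷_; length; map; filter; concatMap; _++_; allFin; drop)
open import Data.List.Properties
  using (length-++; length-map; length-tabulate; filter-++; filter-all; ∷-injectiveˡ; ∷-injectiveʳ; ≡-dec)
open import Data.List.Membership.Propositional using (_∈_; find)
open import Data.List.Membership.Propositional.Properties
  using (∈-++⁺ˡ; ∈-++⁺ʳ; ∈-++⁻; ∈-∃++; ∈-map⁺; ∈-map⁻; ∈-allFin; ∈-filter⁺; ∈-filter⁻; ∈-concatMap⁺; ∈-concatMap⁻)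
import Data.List.Membership.DecPropositional as DecMembership
open import Data.List.Relation.Unary.All as All using (All)
import Data.List.Relation.Unary.All.Properties as All
open import Data.List.Relation.Unary.AllPairs using (_∷_)
import Data.List.Relation.Unary.AllPairs as AllPairs
import Data.List.Relation.Unary.AllPairs.Properties as AllPairs
open import Data.List.Relation.Unary.Any as Any using (here; there)
open import Data.List.Relation.Unary.Any.Properties using (any⁺; any⁻)
open import Data.List.Relation.Unary.Unique.Propositional using (Unique)
import Data.List.Relation.Unary.Unique.Propositional.Properties as Unique
open import Data.List.Relation.Binary.Disjoint.Propositional using (Disjoint)
open import Data.List.Relation.Binary.Pointwise using (≡⇒Pointwise-≡)
open import Data.List.Relation.Binary.Sublist.Propositional using (_⊆_; ⊆-trans)
open import Data.List.Relation.Binary.Sublist.Propositional.Properties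
  using (++⁺ˡ; xs∈xss⇒xs⊆concat[xss]; map⁺; filter⁺; filter-⊆; length-mono-≤)
open import Data.Maybe using (just)
open import Data.Nat using (ℕ; zero; suc; _+_; _∸_; _*_; _^_; _≤_; _<_; _<ᵇ_; _≤ᵇ_; z≤n; s≤s; _≤?_)
open import Data.Nat.Properties
  using (module ≤-Reasoning; +-suc; +-comm; +-mono-≤; *-comm; *-monoʳ-≤; ≤-refl; ≤-trans; ≤-reflexive; ≤-pred;
         m≤n⇒m≤1+n; 1+n≰n; n≮n; n<1+n; ≰⇒>; <⇒<ᵇ; <ᵇ⇒<; ≤ᵇ⇒≤; ∸-+-assoc; ∸-monoʳ-≤; m+n∸n≡m)
open import Data.Product using (∃; ∃₂; _×_; _,_; proj₂)
open import Data.Sum using (_⊎_; inj₁; inj₂)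
open import Function using (_∘_; id; Equivalence)
open import Relation.Binary.Definitions using (DecidableEquality)
open import Relation.Binary.PropositionalEquality
open import Relation.Nullary using (¬_; Dec; yes; no; ¬?; does)
open import Relation.Nullary.Decidable using (T?; dec-true)
open import Relation.Nullary.Negation using (contradiction)
open import Relation.Unary using (Decidable)
open import Relation.Unary.Properties using (∁?)

¬T⇒T-not : ∀ {b} → ¬ T b → T (not b)
¬T⇒T-not {false} _ = _
¬T⇒T-not {true} ¬t = ¬t _

module _ {A : Set} where

  Unique-⊆⇒length≤ : {xs ys : List A} → Unique xs → (∀ {z} → z ∈ xs → z ∈ ys) → length xs ≤ length ys
  Unique-⊆⇒length≤ {[]} _ _ = z≤n
  Unique-⊆⇒length≤ {x ∷ xs} (x∉xs ∷ xs!) xs⊆ys with ∈-∃++ (xs⊆ys (here refl))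
  ... | ys₁ , ys₂ , refl = begin
      suc (length xs)             ≤⟨ s≤s (Unique-⊆⇒length≤ xs! xs⊆ys₁ys₂) ⟩
      suc (length (ys₁ ++ ys₂))   ≡⟨ cong suc (length-++ ys₁) ⟩
      suc (length ys₁ + length ys₂) ≡⟨ +-suc (length ys₁) (length ys₂) ⟨
      length ys₁ + length (x ∷ ys₂) ≡⟨ length-++ ys₁ ⟨
      length (ys₁ ++ x ∷ ys₂)     ∎
    where
      open ≤-Reasoning
      xs⊆ys₁ys₂ : ∀ {z} → z ∈ xs → z ∈ ys₁ ++ ys₂
      xs⊆ys₁ys₂ {z} z∈xs with ∈-++⁻ ys₁ (xs⊆ys (there z∈xs))
      ... | inj₁ z∈ys₁ = ∈-++⁺ˡ z∈ys₁
      ... | inj₂ (here refl) = contradiction refl (All.lookup x∉xs z∈xs)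
      ... | inj₂ (there z∈ys₂) = ∈-++⁺ʳ ys₁ z∈ys₂

  module _ {P : A → Set} (P? : Decidable P) where

    length-filter+length-filter-∁ : (xs : List A) →
      length (filter P? xs) + length (filter (∁? P?) xs) ≡ length xs
    length-filter+length-filter-∁ [] = refl
    length-filter+length-filter-∁ (x ∷ xs) with does (P? x)
    ... | true  = cong suc (length-filter+length-filter-∁ xs)
    ... | false = trans (+-suc _ _) (cong suc (length-filter+length-filter-∁ xs))

    filter-concatMap : ∀ {B : Set} (f : B → List A) (xs : List B) →
      filter P? (concatMap f xs) ≡ concatMap (filter P? ∘ f) xs
    filter-concatMap f [] = refl
    filter-concatMap f (x ∷ xs) =
      trans (filter-++ P? (f x) (concatMap f xs)) (cong (filter P? (f x) ++_) (filter-concatMap f xs))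

  module _ (_≟_ : DecidableEquality A) where

    length≤1+length-filter-≢ : {xs : List A} (y : A) → Unique xs →
      length xs ≤ suc (length (filter (λ z → ¬? (z ≟ y)) xs))
    length≤1+length-filter-≢ {[]} y _ = z≤n
    length≤1+length-filter-≢ {x ∷ xs} y (x∉xs ∷ xs!) with x ≟ y
    ... | yes refl = s≤s (≤-reflexive (cong length (sym (filter-all _ (All.map (_∘ sym) x∉xs)))))
    ... | no _ = s≤s (length≤1+length-filter-≢ y xs!)

  Unique⇒two-distinct : {xs : List A} → Unique xs → 2 ≤ length xs → ∃₂ λ x y → x ∈ xs × y ∈ xs × x ≢ y
  Unique⇒two-distinct {x ∷ y ∷ _} ((x≢y All.∷ _) ∷ _) _ = x , y , here refl , there (here refl) , x≢y
  Unique⇒two-distinct {_ ∷ []} _ (s≤s ())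

module _ {A B : Set} where

  filter-map : {P : B → Set} (P? : Decidable P) (f : A → B) (xs : List A) →
    filter P? (map f xs) ≡ map f (filter (P? ∘ f) xs)
  filter-map P? f [] = refl
  filter-map P? f (x ∷ xs) with does (P? (f x))
  ... | true  = cong (f x ∷_) (filter-map P? f xs)
  ... | false = filter-map P? f xs

  length-concatMap-≥ : {n : ℕ} (f : A → List B) {xs : List A} → (∀ {x} → x ∈ xs → n ≤ length (f x)) →
    length xs * n ≤ length (concatMap f xs)
  length-concatMap-≥ f {[]} _ = z≤n
  length-concatMap-≥ f {x ∷ xs} bound = ≤-trans
    (+-mono-≤ (bound (here refl)) (length-concatMap-≥ f (bound ∘ there)))
    (≤-reflexive (sym (length-++ (f x))))

module _ {C : ℕ} where

  open DecMembership (≡-dec (Fin._≟_ {C})) public using (_∈?_)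

  block : Word C → List (Word C)
  block t = map (_∷ t) (allFin C)

  wordsOfLength-length : ∀ n {v : Word C} → v ∈ wordsOfLength C n → length v ≡ n
  wordsOfLength-length zero (here refl) = refl
  wordsOfLength-length (suc n) v∈ with find (∈-concatMap⁻ block {xs = wordsOfLength C n} v∈)
  ... | t , t∈ , v∈block with ∈-map⁻ (_∷ t) v∈block
  ... | _ , _ , refl = cong suc (wordsOfLength-length n t∈)

  ∈-wordsOfLength : (v : Word C) → v ∈ wordsOfLength C (length v)
  ∈-wordsOfLength [] = here refl
  ∈-wordsOfLength (a ∷ v) =
    ∈-concatMap⁺ block (Any.map (λ { refl → ∈-map⁺ (_∷ v) (∈-allFin a) }) (∈-wordsOfLength v))

  length-block : (t : Word C) → length (block t) ≡ C
  length-block t = trans (length-map (_∷ t) (allFin C)) (length-tabulate id)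

  length-wordsOfLength-≥ : ∀ n → C ^ n ≤ length (wordsOfLength C n)
  length-wordsOfLength-≥ zero = ≤-refl
  length-wordsOfLength-≥ (suc n) = begin
    C * C ^ n                           ≤⟨ *-monoʳ-≤ C (length-wordsOfLength-≥ n) ⟩
    C * length (wordsOfLength C n)      ≡⟨ *-comm C _ ⟩
    length (wordsOfLength C n) * C      ≤⟨ length-concatMap-≥ block {wordsOfLength C n} (≤-reflexive ∘ sym ∘ length-block ∘ _) ⟩
    length (wordsOfLength C (suc n))    ∎
    where open ≤-Reasoning

  wordsOfLength-unique : ∀ n → Unique (wordsOfLength C n)
  wordsOfLength-unique zero = All.[] ∷ AllPairs.[]
  wordsOfLength-unique (suc n) = Unique.concat⁺
    (All.map⁺ (All.universal (λ t → Unique.map⁺ ∷-injectiveˡ (Unique.allFin⁺ C)) (wordsOfLength C n)))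
    (AllPairs.map⁺ (AllPairs.map blocks-disjoint (wordsOfLength-unique n)))
    where
      blocks-disjoint : ∀ {t t′} → t ≢ t′ → Disjoint (block t) (block t′)
      blocks-disjoint t≢t′ (v∈ , v∈′) with ∈-map⁻ _ v∈ | ∈-map⁻ _ v∈′
      ... | _ , _ , refl | _ , _ , eq = t≢t′ (∷-injectiveʳ eq)

  vertices-length : ∀ L {v : Word C} → v ∈ vertices C L → length v ≤ L
  vertices-length zero (here refl) = z≤n
  vertices-length (suc L) {v} v∈ with ∈-++⁻ (vertices C L) v∈
  ... | inj₁ v∈′ = m≤n⇒m≤1+n (vertices-length L v∈′)
  ... | inj₂ v∈′ = ≤-reflexive (wordsOfLength-length (suc L) v∈′)

  block⊆vertices : (t : Word C) → block t ⊆ vertices C (suc (length t))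
  block⊆vertices t = ++⁺ˡ (vertices C (length t))
    (xs∈xss⇒xs⊆concat[xss] (Any.map ≡⇒Pointwise-≡ (∈-map⁺ block (∈-wordsOfLength t))))

  ==⇒≡ : {u v : Word C} → T (u == v) → u ≡ v
  ==⇒≡ {u} {v} _ with yes u≡v ← ≡-dec Fin._≟_ u v = u≡v

  ==-refl : (v : Word C) → T (v == v)
  ==-refl v = Equivalence.from T-≡ (dec-true (≡-dec Fin._≟_ v v) refl)

module _ {C : ℕ} (L : ℕ) where

  closedNbhd⁻ : (u v : Word C) → T (inClosedNbhd L u v) → u ≡ v ⊎ u ∈ nbrs L v
  closedNbhd⁻ u v u∈N[v] with Equivalence.to T-∨ u∈N[v]
  ... | inj₁ u==v = inj₁ (==⇒≡ u==v)
  ... | inj₂ u∈nbrs = inj₂ (Any.map ==⇒≡ (any⁻ (u ==_) (nbrs L v) u∈nbrs))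

  closedNbhd⁺ : {u : Word C} (v : Word C) → u ∈ nbrs L v → T (inClosedNbhd L u v)
  closedNbhd⁺ {u} v u∈ = Equivalence.from T-∨ (inj₂ (any⁺ (u ==_) (Any.map (λ { refl → ==-refl u }) u∈)))

  closedNbhd-refl : (v : Word C) → T (inClosedNbhd L v v)
  closedNbhd-refl v = Equivalence.from T-∨ (inj₁ (==-refl v))

  sibling-closedNbhd : (c d : Fin C) (t : Word C) → T (inClosedNbhd L (d ∷ t) (c ∷ t))
  sibling-closedNbhd c d t = byCases (d Fin.≟ c)
    where
      byCases : Dec (d ≡ c) → T (inClosedNbhd L (d ∷ t) (c ∷ t))
      byCases (yes refl) = closedNbhd-refl (d ∷ t)
      byCases (no d≢c) =
        closedNbhd⁺ (c ∷ t) (∈-++⁺ˡ (∈-map⁺ (_∷ t) (∈-filter⁺ (λ b → ¬? (c Fin.≟ b)) (∈-allFin d) (d≢c ∘ sym))))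

  child-closedNbhd : (d : Fin C) (t : Word C) → length t < L → T (inClosedNbhd L (d ∷ t) t)
  child-closedNbhd d t t<L =
    closedNbhd⁺ t (∈-++⁺ʳ (siblings t) (∈-++⁺ʳ (swapNbr t) (∈-++⁺ˡ d∷t∈children)))
    where
      d∷t∈children : d ∷ t ∈ children L t
      d∷t∈children rewrite Equivalence.to T-≡ (<⇒<ᵇ t<L) = ∈-map⁺ (_∷ t) (∈-allFin d)

  ∈-children⁻ : {d : Fin C} {t v : Word C} → d ∷ t ∈ children L v → v ≡ t
  ∈-children⁻ {v = v} d∷t∈ with length v <ᵇ L
  ... | true with ∈-map⁻ _ d∷t∈
  ...   | _ , _ , refl = refl

module _ {C : ℕ} where

  ∈-siblings⁻ : {d : Fin C} {t v : Word C} → d ∷ t ∈ siblings v → ∃ λ c → v ≡ c ∷ t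
  ∈-siblings⁻ {v = c ∷ _} d∷t∈ with ∈-map⁻ _ d∷t∈
  ... | _ , _ , refl = c , refl

  ∈-parent⁻ : {u v : Word C} → u ∈ parent v → ∃ λ c → v ≡ c ∷ u
  ∈-parent⁻ {v = c ∷ _} (here refl) = c , refl

  swapGo-repeats : ∀ {b x : Fin C} {w} c n t → swapGo c (suc (suc n)) t ≡ just (b ∷ x ∷ w) → b ≡ x
  swapGo-repeats c n (y ∷ t) eq with does (y Fin.≟ c)
  ... | true = swapGo-repeats c (suc n) t eq
  ... | false with refl ← eq = refl

  ∈-swapNbr⁻ : ∀ {b x : Fin C} {w v} → b ≢ x → b ∷ x ∷ w ∈ swapNbr v → v ≡ x ∷ b ∷ w
  ∈-swapNbr⁻ {v = c ∷ t} b≢x leaf∈ with swapGo c 1 t in eq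
  ∈-swapNbr⁻ {v = c ∷ y ∷ t} b≢x (here refl) | just _ with does (y Fin.≟ c)
  ... | true = ⊥-elim (b≢x (swapGo-repeats c 0 t eq))
  ... | false with refl ← eq = refl

  -- swapped is the neighbour of the leaf given by rule (2) with j = 2.
  data LeafNbhd (b x : Fin C) (w : Word C) : Word C → Set where
    sibling  : ∀ c → LeafNbhd b x w (c ∷ x ∷ w)
    parentOf : LeafNbhd b x w (x ∷ w)
    swapped  : LeafNbhd b x w (x ∷ b ∷ w)

  leafNbhd : ∀ {b x : Fin C} {w v} → b ≢ x → length v ≤ 2 + length w →
             T (inClosedNbhd (2 + length w) (b ∷ x ∷ w) v) → LeafNbhd b x w v
  leafNbhd {b} {x} {w} {v} b≢x |v|≤L leaf∈N[v] with closedNbhd⁻ (2 + length w) (b ∷ x ∷ w) v leaf∈N[v]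
  ... | inj₁ refl = sibling _
  ... | inj₂ leaf∈nbrs with ∈-++⁻ (siblings v) leaf∈nbrs
  ...   | inj₁ ∈siblings with c , refl ← ∈-siblings⁻ {v = v} ∈siblings = sibling c
  ...   | inj₂ ∈rest with ∈-++⁻ (swapNbr v) ∈rest
  ...     | inj₁ ∈swapNbr with refl ← ∈-swapNbr⁻ {v = v} b≢x ∈swapNbr = swapped
  ...     | inj₂ ∈rest′ with ∈-++⁻ (children (2 + length w) v) ∈rest′
  ...       | inj₁ ∈children with refl ← ∈-children⁻ (2 + length w) {v = v} ∈children = parentOf
  ...       | inj₂ ∈parent with _ , refl ← ∈-parent⁻ {v = v} ∈parent = ⊥-elim (1+n≰n |v|≤L)

  anchorLetter : ∀ {b x : Fin C} {w v} → LeafNbhd b x w v → Fin C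
  anchorLetter {x = x} (sibling _) = x
  anchorLetter {x = x} parentOf    = x
  anchorLetter {b = b} swapped     = b

  anchor : ℕ → Word C → Word C
  anchor L v = if length v <ᵇ L then v else drop 1 v

  anchor-< : ∀ L v → length v < L → anchor L v ≡ v
  anchor-< L v v<L with length v <ᵇ L in eq
  ... | true  = refl
  ... | false = ⊥-elim (subst T eq (<⇒<ᵇ v<L))

  anchor-≮ : ∀ L v → ¬ length v < L → anchor L v ≡ drop 1 v
  anchor-≮ L v v≮L with length v <ᵇ L in eq
  ... | true  = contradiction (<ᵇ⇒< _ _ (Equivalence.from T-≡ eq)) v≮L
  ... | false = refl

  leafNbhd-anchor : ∀ {b x : Fin C} {w v} (n : LeafNbhd b x w v) → anchor (2 + length w) v ≡ anchorLetter n ∷ w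
  leafNbhd-anchor {w = w} (sibling c) = anchor-≮ _ (c ∷ _ ∷ w) (n≮n _)
  leafNbhd-anchor {w = w} parentOf    = anchor-< _ (_ ∷ w) (n<1+n _)
  leafNbhd-anchor {w = w} swapped     = anchor-≮ _ (_ ∷ _ ∷ w) (n≮n _)

  leafNbhd-block : ∀ {b x : Fin C} {w v} (n : LeafNbhd b x w v) (d : Fin C) →
                   T (inClosedNbhd (2 + length w) (d ∷ anchorLetter n ∷ w) v)
  leafNbhd-block {x = x} {w} (sibling c) d = sibling-closedNbhd (2 + length w) c d (x ∷ w)
  leafNbhd-block {x = x} {w} parentOf d = child-closedNbhd (2 + length w) d (x ∷ w) (n<1+n _)
  leafNbhd-block {b = b} {w = w} swapped d = sibling-closedNbhd (2 + length w) _ d (b ∷ w)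

module ChildrenOf {C : ℕ} (k : ℕ) (S : List (Word C)) (w : Word C) where

  L : ℕ
  L = 2 + length w

  anchors : List (Word C)
  anchors = map (anchor L) S

  Hit : Fin C → Set
  Hit x = x ∷ w ∈ anchors

  hit? : Decidable Hit
  hit? x = x ∷ w ∈? anchors

  unhit : List (Fin C)
  unhit = filter (∁? hit?) (allFin C)

  unhit⁻ : ∀ {d} → d ∈ unhit → ¬ Hit d
  unhit⁻ = proj₂ ∘ ∈-filter⁻ (∁? hit?) {xs = allFin C}

  unhit-unique : Unique unhit
  unhit-unique = Unique.filter⁺ (∁? hit?) (Unique.allFin⁺ C)

  Unreached : (Word C → Bool) → Set
  Unreached P = ∀ {b x} → ¬ Hit b → ¬ Hit x → b ≢ x → ¬ T (P (b ∷ x ∷ w))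

  anchorLetter-unhit : ∀ {b x v} → ¬ Hit b → ¬ Hit x → (n : LeafNbhd b x w v) → ¬ Hit (anchorLetter n)
  anchorLetter-unhit ¬b ¬x (sibling _) = ¬x
  anchorLetter-unhit ¬b ¬x parentOf    = ¬x
  anchorLetter-unhit ¬b ¬x swapped     = ¬b

  unreached-initial : All (IsVertex C L) S → Unreached (powerDom C L k S 0)
  unreached-initial vs {b} {x} ¬b ¬x b≢x reached with s , s∈S , leaf∈N[s] ← find (any⁻ _ S reached) =
    anchorLetter-unhit ¬b ¬x n (subst (_∈ anchors) (leafNbhd-anchor n) (∈-map⁺ (anchor L) s∈S))
    where
      n : LeafNbhd b x w s
      n = leafNbhd b≢x (All.lookup vs s∈S) leaf∈N[s]

  outsideCount-≥ : ∀ {P y v} → Unreached P → ¬ Hit y → (∀ d → T (inClosedNbhd L (d ∷ y ∷ w) v)) →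
                   length (filter (λ d → ¬? (d Fin.≟ y)) unhit) ≤ outsideCount C L k P v
  outsideCount-≥ {P} {y} {v} unreached ¬y N[v]⊇block = begin
      length ds                                ≡⟨ length-map (_∷ y ∷ w) ds ⟨
      length (map (_∷ y ∷ w) ds)               ≡⟨ cong length (filter-all (T? ∘ Outside) allOutside) ⟨
      length (filter (T? ∘ Outside) (map (_∷ y ∷ w) ds))
        ≤⟨ length-mono-≤ (filter⁺ (T? ∘ Outside) (T? ∘ Outside) (λ { refl → id }) ds⊆vertices) ⟩
      outsideCount C L k P v                   ∎
    where
      open ≤-Reasoning
      ds : List (Fin C)
      ds = filter (λ d → ¬? (d Fin.≟ y)) unhit
      Outside : Word C → Bool
      Outside z = inClosedNbhd L z v ∧ not (P z)
      ds⊆vertices : map (_∷ y ∷ w) ds ⊆ vertices C L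
      ds⊆vertices = ⊆-trans (map⁺ (_∷ y ∷ w) (⊆-trans (filter-⊆ _ unhit) (filter-⊆ _ (allFin C))))
                            (block⊆vertices (y ∷ w))
      allOutside : All (T ∘ Outside) (map (_∷ y ∷ w) ds)
      allOutside = All.map⁺ (All.tabulate λ {d} d∈ds →
        let d∈unhit , d≢y = ∈-filter⁻ (λ d → ¬? (d Fin.≟ y)) {xs = unhit} d∈ds
        in Equivalence.from T-∧ (N[v]⊇block d , ¬T⇒T-not (unreached (unhit⁻ d∈unhit) ¬y d≢y)))

  module _ (many : suc (suc k) ≤ length unhit) where

    unreached-step : ∀ {P} → Unreached P → Unreached (step C L k P)
    unreached-step {P} unreached {b} {x} ¬b ¬x b≢x reached
      with v , v∈V , Pv∧few∧leaf∈N[v] ← find (any⁻ _ (vertices C L) reached)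
      with _ , few∧leaf∈N[v] ← Equivalence.to (T-∧ {P v}) Pv∧few∧leaf∈N[v]
      with few , leaf∈N[v] ← Equivalence.to (T-∧ {outsideCount C L k P v ≤ᵇ k}) few∧leaf∈N[v] =
      1+n≰n (begin
        suc k                                         ≤⟨ ≤-pred (≤-trans many (length≤1+length-filter-≢ Fin._≟_ y unhit-unique)) ⟩
        length (filter (λ d → ¬? (d Fin.≟ y)) unhit)  ≤⟨ outsideCount-≥ unreached ¬y (leafNbhd-block n) ⟩
        outsideCount C L k P v                        ≤⟨ ≤ᵇ⇒≤ _ k few ⟩
        k                                             ∎)
      where
        open ≤-Reasoning
        n : LeafNbhd b x w v
        n = leafNbhd b≢x (vertices-length L v∈V) leaf∈N[v]
        y : Fin C
        y = anchorLetter n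
        ¬y : ¬ Hit y
        ¬y = anchorLetter-unhit ¬b ¬x n

    unreached : All (IsVertex C L) S → ∀ i → Unreached (powerDom C L k S i)
    unreached vs zero    = unreached-initial vs
    unreached vs (suc i) = unreached-step {powerDom C L k S i} (unreached vs i)

  length-unhit-≤ : All (IsVertex C L) S → IsKPDS C L k S → length unhit ≤ suc k
  length-unhit-≤ vs kpds with suc (suc k) ≤? length unhit
  ... | no few = ≤-pred (≰⇒> few)
  ... | yes many
    with x , b , x∈ , b∈ , x≢b ← Unique⇒two-distinct unhit-unique (≤-trans (s≤s (s≤s z≤n)) many)
    with i , reached ← kpds (b ∷ x ∷ w) ≤-refl =
    ⊥-elim (unreached many vs i (unhit⁻ b∈) (unhit⁻ x∈) (x≢b ∘ sym) (Equivalence.from T-≡ reached))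

  anchoredChildren-≥ : ∀ {m} → length w ≡ m → All (IsVertex C (2 + m)) S → IsKPDS C (2 + m) k S →
                       C ∸ k ∸ 1 ≤ length (filter (_∈? map (anchor (2 + m)) S) (block w))
  anchoredChildren-≥ refl vs kpds = begin
      C ∸ k ∸ 1                             ≡⟨ ∸-+-assoc C k 1 ⟩
      C ∸ (k + 1)                           ≤⟨ ∸-monoʳ-≤ C (subst (length unhit ≤_) (+-comm 1 k) (length-unhit-≤ vs kpds)) ⟩
      C ∸ length unhit                      ≡⟨ cong (_∸ length unhit) partition ⟨
      length hits + length unhit ∸ length unhit ≡⟨ m+n∸n≡m (length hits) (length unhit) ⟩
      length hits                           ≡⟨ length-map (_∷ w) hits ⟨
      length (map (_∷ w) hits)              ≡⟨ cong length (filter-map (_∈? anchors) (_∷ w) (allFin C)) ⟨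
      length (filter (_∈? anchors) (block w)) ∎
    where
      open ≤-Reasoning
      hits : List (Fin C)
      hits = filter hit? (allFin C)
      partition : length hits + length unhit ≡ C
      partition = trans (length-filter+length-filter-∁ hit? (allFin C)) (length-tabulate id)

kpds-length-≥ : ∀ {C} k m (S : List (Word C)) → All (IsVertex C (2 + m)) S → IsKPDS C (2 + m) k S →
                (C ∸ k ∸ 1) * C ^ m ≤ length S
kpds-length-≥ {C} k m S vs kpds = begin
    (C ∸ k ∸ 1) * C ^ m                       ≤⟨ *-monoʳ-≤ (C ∸ k ∸ 1) (length-wordsOfLength-≥ m) ⟩
    (C ∸ k ∸ 1) * length ws                   ≡⟨ *-comm (C ∸ k ∸ 1) (length ws) ⟩
    length ws * (C ∸ k ∸ 1)                   ≤⟨ length-concatMap-≥ anchoredChildren anchoredChildren-≥ ⟩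
    length (concatMap anchoredChildren ws)    ≡⟨ cong length (filter-concatMap (_∈? anchors) block ws) ⟨
    length anchoredWords                      ≤⟨ anchoredWords-≤ ⟩
    length anchors                            ≡⟨ length-map (anchor (2 + m)) S ⟩
    length S                                  ∎
  where
    open ≤-Reasoning
    ws : List (Word C)
    ws = wordsOfLength C m
    anchors : List (Word C)
    anchors = map (anchor (2 + m)) S
    anchoredChildren : Word C → List (Word C)
    anchoredChildren = filter (_∈? anchors) ∘ block
    anchoredChildren-≥ : ∀ {w} → w ∈ ws → C ∸ k ∸ 1 ≤ length (anchoredChildren w)
    anchoredChildren-≥ w∈ = ChildrenOf.anchoredChildren-≥ k S _ (wordsOfLength-length m w∈) vs kpds
    anchoredWords : List (Word C)
    anchoredWords = filter (_∈? anchors) (wordsOfLength C (suc m))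
    anchoredWords-≤ : length anchoredWords ≤ length anchors
    anchoredWords-≤ = Unique-⊆⇒length≤ (Unique.filter⁺ (_∈? anchors) (wordsOfLength-unique (suc m)))
                                       (proj₂ ∘ ∈-filter⁻ (_∈? anchors) {xs = wordsOfLength C (suc m)})

mainTheorem6 : (C L k : ℕ) → 3 ≤ C → 3 ≤ L → 1 ≤ k → k ≤ C ∸ 2 →
               (S : List (Word C)) → All (IsVertex C L) S → IsKPDS C L k S →
               (C ∸ k ∸ 1) * C ^ (L ∸ 2) ≤ length S
mainTheorem6 C (suc (suc m)) k _ _ _ _ S vs kpds = kpds-length-≥ k m S vs kpds
mainTheorem6 C (suc zero) k _ (s≤s ()) _ _ _ _ _
mainTheorem6 C zero k _ () _ _ _ _ _
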